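{- Let $E(u,v)=\sum_{p\geq0,q\geq1}E_{p,q}(t)u^pv^q$, where $E_{p,q}(t)=\sum_{n\geq1}|\{e\in\mathbf{I}_n(\geq,\geq,-): e \text{ has parameters }(p,q)\}|\,t^n$. Then $$\Bigl(1+\frac{tv}{1-u}+\frac{tv}{1-v/u}\Bigr)E(u,v)=tuv+\frac{tv}{1-u}E(1,v)+\frac{tv}{1-v/u}E(u,u).$$
   Context: $\mathbf{I}_n=\{(e_1,\ldots,e_n): 0\leq e_i<i\}$ is the set of inversion sequences of length $n$; $\mathbf{I}_n(\geq,\geq,-)$ is the subset of those with no indices $i<j<k$ such that $e_i\geq e_j\geq e_k$. An entry $e_i$ is a left-to-right maximum if $e_i>e_j$ for all $j<i$. For $e\in\mathbf{I}_n(\geq,\geq,-)$, let $\alpha(e)=\max\{e_1,\ldots,e_n\}$ and let $\beta(e)$ be the largest element of $\{e_i: e_i \text{ is not a left-to-right maximum}\}\cup\{ -1\}$. The parameters of $e$ are $(p,q)$ with $p=\alpha(e)-\beta(e)$ and $q=n-\alpha(e)$. -}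

module Defs where

open import Data.Bool using (Bool; true; false; _∧_; _∨_; if_then_else_)
open import Data.Nat using (ℕ; zero; suc; _⊔_; _∸_; _≤ᵇ_; _<ᵇ_)
open import Data.List using (List; []; _∷_; _++_; [_]; map; concatMap; upTo; filterᵇ; foldr; length)
open import Data.Bool.ListAction using (any)
open import Data.Integer using (ℤ; _+_; _*_; _^_; 0ℤ; 1ℤ)

-- Inversion sequences of length n, as lists (e₁,…,eₙ) with 0 ≤ eᵢ < i.
invSeqs : ℕ → List (List ℕ)
invSeqs zero    = [] ∷ []
invSeqs (suc n) = concatMap (λ e → map (λ x → e ++ [ x ]) (upTo (suc n))) (invSeqs n)

has2 : ℕ → List ℕ → Bool
has2 x []       = false
has2 x (y ∷ ys) = ((y ≤ᵇ x) ∧ any (λ z → z ≤ᵇ y) ys) ∨ has2 x ys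

has3 : List ℕ → Bool
has3 []       = false
has3 (x ∷ xs) = has2 x xs ∨ has3 xs

avoids : List ℕ → Bool
avoids e = if has3 e then false else true

avoiders : ℕ → List (List ℕ)
avoiders n = filterᵇ avoids (invSeqs n)

alpha : List ℕ → ℕ
alpha = foldr _⊔_ 0

-- β(e) + 1 : (largest non-left-to-right-maximum entry) + 1, or 0 if none
-- (so that β = -1 corresponds to 0).
betaGo : ℕ → List ℕ → ℕ
betaGo m []       = 0
betaGo m (y ∷ ys) = if m <ᵇ y then betaGo y ys else (suc y ⊔ betaGo m ys)

betaSuc : List ℕ → ℕ
betaSuc []       = 0
betaSuc (x ∷ xs) = betaGo x xs

-- parameters (p , q): p = α - β = (α + 1) - (β + 1),  q = n - α
paramP : List ℕ → ℕ
paramP e = suc (alpha e) ∸ betaSuc e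

paramQ : ℕ → List ℕ → ℕ
paramQ n e = n ∸ alpha e

-- Coefficient of t^n in E(u,v) after the substitution given by f:
--   Σ_{e ∈ I_n(≥,≥,-), q(e) ≥ 1} f (p e) (q e)
-- (only parameters with q ≥ 1 contribute, as in E = Σ_{p≥0,q≥1} E_{p,q} u^p v^q).
Ecoef : ℕ → (ℕ → ℕ → ℤ) → ℤ
Ecoef n f = foldr (λ e acc → (if 1 ≤ᵇ paramQ n e then f (paramP e) (paramQ n e) else 0ℤ) + acc)
                  0ℤ (avoiders n)

E[u,v] : ℕ → ℤ → ℤ → ℤ
E[u,v] n u v = Ecoef n (λ p q → u ^ p * v ^ q)

E[1,v] : ℕ → ℤ → ℤ
E[1,v] n v = Ecoef n (λ p q → 1ℤ' ^ p * v ^ q)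
  where 1ℤ' : ℤ
        1ℤ' = 1ℤ
        
E[u,u] : ℕ → ℤ → ℤ
E[u,u] n u = Ecoef n (λ p q → u ^ p * u ^ q)

-- [m = 0] (the coefficient of t^(m+1) in t u v is [m = 0] u v)
case-m : ℕ → ℤ
case-m zero    = 1ℤ
case-m (suc _) = 0ℤ

-- Every sequence in I_{n+1} is e ∷ʳ x for a unique e ∈ I_n, and appending x creates a
-- (≥,≥,-) pattern exactly when x ≤ β(e). If e avoids the pattern and has parameters (p, q),
-- its children with β < x = β + 1 + i ≤ α have parameters (p - 1 - i, q + 1), and those with
-- x = α + 1 + j ≤ n have parameters (p + 1 + j, q - j). Both families are geometric
-- progressions in u (resp. u and v), so after clearing the denominators (1 - u)(u - v) each
-- e contributes the same amount to both sides of the coefficient of t^{n+1}.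
module Submission where

open import Defs
open import Algebra.Bundles using (CommutativeMonoid)
import Algebra.Properties.CommutativeSemigroup as CommSemigroupProperties
import Data.Bool as Bool
open import Data.Bool using (Bool; true; false; _∧_; _∨_; if_then_else_; T)
open import Data.Bool.Properties
  using (∨-assoc; ∨-comm; ∨-identityʳ; ∨-zeroʳ; ∧-zeroʳ; ∧-distribˡ-∨; ∨-commutativeMonoid; T-∧; ¬-not)
open import Data.Bool.ListAction using (any)
open import Data.Empty using (⊥-elim)
open import Data.Unit using (tt)
open import Data.Nat using (ℕ; zero; suc; _⊔_; _∸_; _≤ᵇ_; _<ᵇ_; _≤_; _<_; z≤n; s≤s)
import Data.Nat as ℕ
open import Data.Nat.Properties
  using (≤-trans; ≤-<-connex; <⇒≤; ≤ᵇ⇒≤; ≤⇒≤ᵇ; m≤n⇒m⊔n≡n; m≥n⇒m⊔n≡m; ⊔-identityʳ; ⊔-assoc;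
         ⊔-lub; m≤m⊔n; n≤1+n; m<n⇒0<n∸m; ≤-pred; m≤m+n; +-suc; +-assoc; +-monoʳ-≤; +-monoʳ-<;
         m+[n∸m]≡n; [m+n]∸[m+o]≡n∸o; m+n∸m≡n; +-∸-assoc; m≤n⊔m; ⊔-monoʳ-≤; ⊔-commutativeSemigroup)
open import Data.List using (List; []; _∷_; _++_; _∷ʳ_; foldr; map; concat; applyUpTo; upTo; filterᵇ)
open import Data.List.Relation.Unary.All as All using (All; []; _∷_)
open import Data.List.Relation.Unary.All.Properties using (concat⁺; map⁺; applyUpTo⁺₁)
open import Data.List.Relation.Unary.Any as Any using ()
open import Data.List.Relation.Unary.Any.Properties using (any⁺; any⁻)
open import Data.Integer using (ℤ; _+_; _-_; _*_; _^_; 0ℤ; 1ℤ)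
import Data.Integer.Properties as ℤ
open import Data.Integer.Tactic.RingSolver using (solve-∀)
open import Data.Product using (_,_)
open import Data.Sum using (inj₁; inj₂)
open import Function using (id; _∘_; Equivalence)
open import Relation.Binary.PropositionalEquality
open import Relation.Nullary using (yes; no)
open ≡-Reasoning

open CommSemigroupProperties (CommutativeMonoid.commutativeSemigroup ∨-commutativeMonoid)
  using () renaming (interchange to ∨-interchange)
open CommSemigroupProperties ⊔-commutativeSemigroup
  using () renaming (x∙yz≈y∙xz to ⊔-exchange)

<ᵇ-true : ∀ {m n} → m < n → (m <ᵇ n) ≡ true
<ᵇ-true (s≤s z≤n)       = refl
<ᵇ-true (s≤s (s≤s m≤n)) = <ᵇ-true (s≤s m≤n)

<ᵇ-false : ∀ {m n} → n ≤ m → (m <ᵇ n) ≡ false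
<ᵇ-false z≤n       = refl
<ᵇ-false (s≤s n≤m) = <ᵇ-false n≤m

≤ᵇ-true : ∀ {m n} → m ≤ n → (m ≤ᵇ n) ≡ true
≤ᵇ-true z≤n         = refl
≤ᵇ-true m≤n@(s≤s _) = <ᵇ-true m≤n

≤ᵇ-false : ∀ {m n} → n < m → (m ≤ᵇ n) ≡ false
≤ᵇ-false (s≤s n≤m) = <ᵇ-false n≤m

<ᵇ-suc : ∀ m n → (m <ᵇ suc n) ≡ (m ≤ᵇ n)
<ᵇ-suc zero    n = refl
<ᵇ-suc (suc m) n = refl

<ᵇ-⊔ : ∀ m a b → (m <ᵇ a ⊔ b) ≡ (m <ᵇ a) ∨ (m <ᵇ b)
<ᵇ-⊔ m       zero    b       = refl
<ᵇ-⊔ m       (suc a) zero    = sym (∨-identityʳ _)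
<ᵇ-⊔ zero    (suc a) (suc b) = refl
<ᵇ-⊔ (suc m) (suc a) (suc b) = <ᵇ-⊔ m a b

implies⇒∨≡ʳ : ∀ {a b} → (T a → T b) → a ∨ b ≡ b
implies⇒∨≡ʳ {false}        _   = refl
implies⇒∨≡ʳ {true} {true}  _   = refl
implies⇒∨≡ʳ {true} {false} a⇒b = ⊥-elim (a⇒b tt)

any-∷ʳ : ∀ {A : Set} (p : A → Bool) xs x → any p (xs ∷ʳ x) ≡ any p xs ∨ p x
any-∷ʳ p []       x = ∨-identityʳ (p x)
any-∷ʳ p (y ∷ ys) x = trans (cong (p y ∨_) (any-∷ʳ p ys x)) (sym (∨-assoc (p y) (any p ys) (p x)))

hasBetween : ℕ → ℕ → List ℕ → Bool
hasBetween x m = any (λ z → (z ≤ᵇ m) ∧ (x ≤ᵇ z))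

hasBetween-mono : ∀ {x m m′} → m ≤ m′ → ∀ zs → T (hasBetween x m zs) → T (hasBetween x m′ zs)
hasBetween-mono {x} {m} {m′} m≤m′ zs = any⁺ _ ∘ Any.map widen ∘ any⁻ _ zs
  where
  widen : ∀ {z} → T ((z ≤ᵇ m) ∧ (x ≤ᵇ z)) → T ((z ≤ᵇ m′) ∧ (x ≤ᵇ z))
  widen {z} t with Equivalence.to T-∧ t
  ... | z≤ᵇm , x≤ᵇz = Equivalence.from T-∧ (≤⇒≤ᵇ (≤-trans (≤ᵇ⇒≤ z m z≤ᵇm) m≤m′) , x≤ᵇz)

has2-∷ʳ : ∀ y zs x → has2 y (zs ∷ʳ x) ≡ has2 y zs ∨ hasBetween x y zs
has2-∷ʳ y []       x = cong (_∨ false) (∧-zeroʳ (x ≤ᵇ y))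
has2-∷ʳ y (z ∷ zs) x = begin
  ((z ≤ᵇ y) ∧ any (_≤ᵇ z) (zs ∷ʳ x)) ∨ has2 y (zs ∷ʳ x)
    ≡⟨ cong₂ (λ a b → ((z ≤ᵇ y) ∧ a) ∨ b) (any-∷ʳ (_≤ᵇ z) zs x) (has2-∷ʳ y zs x) ⟩
  ((z ≤ᵇ y) ∧ (any (_≤ᵇ z) zs ∨ (x ≤ᵇ z))) ∨ (has2 y zs ∨ hasBetween x y zs)
    ≡⟨ cong (_∨ _) (∧-distribˡ-∨ (z ≤ᵇ y) _ _) ⟩
  (((z ≤ᵇ y) ∧ any (_≤ᵇ z) zs) ∨ ((z ≤ᵇ y) ∧ (x ≤ᵇ z))) ∨ (has2 y zs ∨ hasBetween x y zs)
    ≡⟨ ∨-interchange ((z ≤ᵇ y) ∧ any (_≤ᵇ z) zs) ((z ≤ᵇ y) ∧ (x ≤ᵇ z)) (has2 y zs) (hasBetween x y zs) ⟩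
  (((z ≤ᵇ y) ∧ any (_≤ᵇ z) zs) ∨ has2 y zs) ∨ (((z ≤ᵇ y) ∧ (x ≤ᵇ z)) ∨ hasBetween x y zs) ∎

-- With m the running maximum, the entries of ys that are at most m are exactly the
-- non-left-to-right maxima that ys itself does not see.
<ᵇ-betaGo : ∀ m ys x → (x <ᵇ betaGo m ys) ≡ hasBetween x m ys ∨ (x <ᵇ betaSuc ys)
<ᵇ-betaGo m []       x = refl
<ᵇ-betaGo m (z ∷ zs) x with ≤-<-connex z m
... | inj₂ m<z rewrite <ᵇ-true m<z | ≤ᵇ-false m<z = begin
  x <ᵇ betaGo z zs          ≡⟨ <ᵇ-betaGo z zs x ⟩
  Bz ∨ β                    ≡⟨ cong (_∨ β) (implies⇒∨≡ʳ (hasBetween-mono {x} (<⇒≤ m<z) zs)) ⟨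
  (Bm ∨ Bz) ∨ β             ≡⟨ ∨-assoc Bm Bz β ⟩
  Bm ∨ (Bz ∨ β)             ≡⟨ cong (Bm ∨_) (<ᵇ-betaGo z zs x) ⟨
  Bm ∨ (x <ᵇ betaGo z zs)   ∎
  where
  Bm = hasBetween x m zs
  Bz = hasBetween x z zs
  β = x <ᵇ betaSuc zs
... | inj₁ z≤m rewrite <ᵇ-false z≤m | ≤ᵇ-true z≤m = begin
  x <ᵇ suc z ⊔ betaGo m zs              ≡⟨ <ᵇ-⊔ x (suc z) (betaGo m zs) ⟩
  (x <ᵇ suc z) ∨ (x <ᵇ betaGo m zs)     ≡⟨ cong₂ _∨_ (<ᵇ-suc x z) (<ᵇ-betaGo m zs x) ⟩
  (x ≤ᵇ z) ∨ (Bm ∨ β)                   ≡⟨ cong (λ b → (x ≤ᵇ z) ∨ (b ∨ β)) Bz∨Bm≡Bm ⟨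
  (x ≤ᵇ z) ∨ ((Bz ∨ Bm) ∨ β)            ≡⟨ cong (λ b → (x ≤ᵇ z) ∨ (b ∨ β)) (∨-comm Bz Bm) ⟩
  (x ≤ᵇ z) ∨ ((Bm ∨ Bz) ∨ β)            ≡⟨ cong ((x ≤ᵇ z) ∨_) (∨-assoc Bm Bz β) ⟩
  (x ≤ᵇ z) ∨ (Bm ∨ (Bz ∨ β))            ≡⟨ ∨-assoc (x ≤ᵇ z) Bm (Bz ∨ β) ⟨
  ((x ≤ᵇ z) ∨ Bm) ∨ (Bz ∨ β)            ≡⟨ cong (((x ≤ᵇ z) ∨ Bm) ∨_) (<ᵇ-betaGo z zs x) ⟨
  ((x ≤ᵇ z) ∨ Bm) ∨ (x <ᵇ betaGo z zs)  ∎
  where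
  Bm = hasBetween x m zs
  Bz = hasBetween x z zs
  β = x <ᵇ betaSuc zs
  Bz∨Bm≡Bm : Bz ∨ Bm ≡ Bm
  Bz∨Bm≡Bm = implies⇒∨≡ʳ (hasBetween-mono {x} z≤m zs)

-- A new pattern must end at x, and its middle entry is a non-left-to-right maximum ≥ x.
has3-∷ʳ : ∀ e x → has3 (e ∷ʳ x) ≡ has3 e ∨ (x <ᵇ betaSuc e)
has3-∷ʳ []       x = refl
has3-∷ʳ (y ∷ ys) x = begin
  has2 y (ys ∷ʳ x) ∨ has3 (ys ∷ʳ x)
    ≡⟨ cong₂ _∨_ (has2-∷ʳ y ys x) (has3-∷ʳ ys x) ⟩
  (has2 y ys ∨ hasBetween x y ys) ∨ (has3 ys ∨ (x <ᵇ betaSuc ys))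
    ≡⟨ ∨-interchange (has2 y ys) (hasBetween x y ys) (has3 ys) (x <ᵇ betaSuc ys) ⟩
  (has2 y ys ∨ has3 ys) ∨ (hasBetween x y ys ∨ (x <ᵇ betaSuc ys))
    ≡⟨ cong (has3 (y ∷ ys) ∨_) (<ᵇ-betaGo y ys x) ⟨
  has3 (y ∷ ys) ∨ (x <ᵇ betaGo y ys) ∎

alpha-∷ʳ : ∀ e x → alpha (e ∷ʳ x) ≡ alpha e ⊔ x
alpha-∷ʳ []       x = ⊔-identityʳ x
alpha-∷ʳ (y ∷ ys) x = trans (cong (y ⊔_) (alpha-∷ʳ ys x)) (sym (⊔-assoc y (alpha ys) x))

betaGo-∷ʳ : ∀ m ys x →
  betaGo m (ys ∷ʳ x) ≡ (if m ⊔ alpha ys <ᵇ x then betaGo m ys else suc x ⊔ betaGo m ys)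
betaGo-∷ʳ m []       x rewrite ⊔-identityʳ m = refl
betaGo-∷ʳ m (z ∷ zs) x with ≤-<-connex z m
... | inj₂ m<z rewrite <ᵇ-true m<z
                     | m≤n⇒m⊔n≡n (≤-trans (<⇒≤ m<z) (m≤m⊔n z (alpha zs))) = betaGo-∷ʳ z zs x
... | inj₁ z≤m rewrite <ᵇ-false z≤m | betaGo-∷ʳ m zs x
                     | sym (⊔-assoc m z (alpha zs)) | m≥n⇒m⊔n≡m z≤m
                     with m ⊔ alpha zs <ᵇ x
...   | true  = refl
...   | false = ⊔-exchange (suc z) (suc x) (betaGo m zs)

betaGo≤ : ∀ m ys → betaGo m ys ≤ suc (m ⊔ alpha ys)
betaGo≤ m []       = z≤n
betaGo≤ m (z ∷ zs) with ≤-<-connex z m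
... | inj₂ m<z rewrite <ᵇ-true m<z = ≤-trans (betaGo≤ z zs) (s≤s (m≤n⊔m m (z ⊔ alpha zs)))
... | inj₁ z≤m rewrite <ᵇ-false z≤m =
  ⊔-lub (s≤s (≤-trans z≤m (m≤m⊔n m (z ⊔ alpha zs))))
        (≤-trans (betaGo≤ m zs) (s≤s (⊔-monoʳ-≤ m (m≤n⊔m z (alpha zs)))))

sumL : {A : Set} → (A → ℤ) → List A → ℤ
sumL f = foldr (λ a s → f a + s) 0ℤ

sumL-++ : {A : Set} (f : A → ℤ) (xs ys : List A) → sumL f (xs ++ ys) ≡ sumL f xs + sumL f ys
sumL-++ f []       ys = sym (ℤ.+-identityˡ (sumL f ys))
sumL-++ f (x ∷ xs) ys = trans (cong (f x +_) (sumL-++ f xs ys)) (sym (ℤ.+-assoc (f x) _ _))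

sumL-concat : {A : Set} (f : A → ℤ) (xss : List (List A)) → sumL f (concat xss) ≡ sumL (sumL f) xss
sumL-concat f []         = refl
sumL-concat f (xs ∷ xss) = trans (sumL-++ f xs (concat xss)) (cong (sumL f xs +_) (sumL-concat f xss))

sumL-map : {A B : Set} (f : B → ℤ) (g : A → B) (xs : List A) → sumL f (map g xs) ≡ sumL (f ∘ g) xs
sumL-map f g []       = refl
sumL-map f g (x ∷ xs) = cong (f (g x) +_) (sumL-map f g xs)

sumL-filterᵇ : {A : Set} (P : A → Bool) (f : A → ℤ) (xs : List A) →
  sumL f (filterᵇ P xs) ≡ sumL (λ x → if P x then f x else 0ℤ) xs
sumL-filterᵇ P f []       = refl
sumL-filterᵇ P f (x ∷ xs) with P x
... | true  = cong (f x +_) (sumL-filterᵇ P f xs)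
... | false = trans (sumL-filterᵇ P f xs) (sym (ℤ.+-identityˡ _))

sumL-cong : {A : Set} {f g : A → ℤ} (xs : List A) → (∀ x → f x ≡ g x) → sumL f xs ≡ sumL g xs
sumL-cong []       f≗g = refl
sumL-cong (x ∷ xs) f≗g = cong₂ _+_ (f≗g x) (sumL-cong xs f≗g)

sumL-congᴬ : {A : Set} {P : A → Set} {f g : A → ℤ} {xs : List A} →
  All P xs → (∀ {x} → P x → f x ≡ g x) → sumL f xs ≡ sumL g xs
sumL-congᴬ []         f≗g = refl
sumL-congᴬ (px ∷ pxs) f≗g = cong₂ _+_ (f≗g px) (sumL-congᴬ pxs f≗g)

sumL-lincomb : {A : Set} (a b : ℤ) (f g : A → ℤ) (xs : List A) →
  a * sumL f xs + b * sumL g xs ≡ sumL (λ x → a * f x + b * g x) xs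
sumL-lincomb a b f g []       = cong₂ _+_ (ℤ.*-zeroʳ a) (ℤ.*-zeroʳ b)
sumL-lincomb a b f g (x ∷ xs) = begin
  a * (f x + F) + b * (g x + G)        ≡⟨ distribute a b (f x) (g x) F G ⟩
  (a * f x + b * g x) + (a * F + b * G) ≡⟨ cong (a * f x + b * g x +_) (sumL-lincomb a b f g xs) ⟩
  (a * f x + b * g x) + sumL (λ x → a * f x + b * g x) xs ∎
  where
  F = sumL f xs
  G = sumL g xs
  distribute : ∀ a b fx gx F G → a * (fx + F) + b * (gx + G) ≡ (a * fx + b * gx) + (a * F + b * G)
  distribute = solve-∀

sumN : ℕ → (ℕ → ℤ) → ℤ
sumN zero    f = 0ℤ
sumN (suc n) f = f 0 + sumN n (f ∘ suc)

sumL-applyUpTo : (f : ℕ → ℤ) (g : ℕ → ℕ) (n : ℕ) → sumL f (applyUpTo g n) ≡ sumN n (f ∘ g)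
sumL-applyUpTo f g zero    = refl
sumL-applyUpTo f g (suc n) = cong (f (g 0) +_) (sumL-applyUpTo f (g ∘ suc) n)

sumN-cong : ∀ n {f g : ℕ → ℤ} → (∀ {i} → i < n → f i ≡ g i) → sumN n f ≡ sumN n g
sumN-cong zero    f≗g = refl
sumN-cong (suc n) f≗g = cong₂ _+_ (f≗g (s≤s z≤n)) (sumN-cong n (f≗g ∘ s≤s))

sumN-zero : ∀ n {f : ℕ → ℤ} → (∀ {i} → i < n → f i ≡ 0ℤ) → sumN n f ≡ 0ℤ
sumN-zero zero    f≗0 = refl
sumN-zero (suc n) f≗0 = cong₂ _+_ (f≗0 (s≤s z≤n)) (sumN-zero n (f≗0 ∘ s≤s))

sumN-+ : ∀ m n (f : ℕ → ℤ) → sumN (m ℕ.+ n) f ≡ sumN m f + sumN n (λ i → f (m ℕ.+ i))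
sumN-+ zero    n f = sym (ℤ.+-identityˡ _)
sumN-+ (suc m) n f = trans (cong (f 0 +_) (sumN-+ m n (f ∘ suc))) (sym (ℤ.+-assoc (f 0) _ _))

sumN-*ˡ : ∀ n c (f : ℕ → ℤ) → sumN n (λ i → c * f i) ≡ c * sumN n f
sumN-*ˡ zero    c f = sym (ℤ.*-zeroʳ c)
sumN-*ˡ (suc n) c f = trans (cong (c * f 0 +_) (sumN-*ˡ n c (f ∘ suc))) (sym (ℤ.*-distribˡ-+ c (f 0) _))

geomSum : ℤ → ℤ → ℕ → ℤ
geomSum x y q = sumN q (λ j → x ^ j * y ^ (q ∸ suc j))

geomSum-suc : ∀ x y q → geomSum x y (suc q) ≡ y ^ q + x * geomSum x y q
geomSum-suc x y q = cong₂ _+_ (ℤ.*-identityˡ (y ^ q))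
  (trans (sumN-cong q (λ {j} _ → ℤ.*-assoc x (x ^ j) (y ^ (q ∸ suc j)))) (sumN-*ˡ q x _))

geometric : ∀ x y q → (x - y) * geomSum x y q ≡ x ^ q - y ^ q
geometric x y zero    = ℤ.*-zeroʳ (x - y)
geometric x y (suc q) = begin
  (x - y) * geomSum x y (suc q)              ≡⟨ cong ((x - y) *_) (geomSum-suc x y q) ⟩
  (x - y) * (y ^ q + x * geomSum x y q)      ≡⟨ expand x y (y ^ q) (geomSum x y q) ⟩
  (x - y) * y ^ q + x * ((x - y) * geomSum x y q) ≡⟨ cong (λ s → (x - y) * y ^ q + x * s) (geometric x y q) ⟩
  (x - y) * y ^ q + x * (x ^ q - y ^ q)      ≡⟨ telescope x y (x ^ q) (y ^ q) ⟩
  x * x ^ q - y * y ^ q                      ∎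
  where
  expand : ∀ x y Y G → (x - y) * (Y + x * G) ≡ (x - y) * Y + x * ((x - y) * G)
  expand = solve-∀
  telescope : ∀ x y X Y → (x - y) * Y + x * (X - Y) ≡ x * X - y * Y
  telescope = solve-∀

sumN-blocks : ∀ b p q (F : ℕ → ℤ) →
  sumN (b ℕ.+ p ℕ.+ q) F ≡ sumN b F + sumN p (λ i → F (b ℕ.+ i)) + sumN q (λ j → F (b ℕ.+ p ℕ.+ j))
sumN-blocks b p q F =
  trans (sumN-+ (b ℕ.+ p) q F) (cong (_+ sumN q (λ j → F (b ℕ.+ p ℕ.+ j))) (sumN-+ b p F))

weight : (ℕ → ℕ → ℤ) → ℕ → List ℕ → ℤ
weight f n e = if 1 ≤ᵇ paramQ n e then f (paramP e) (paramQ n e) else 0ℤ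

term : (ℕ → ℕ → ℤ) → ℕ → List ℕ → ℤ
term f n e = if avoids e then weight f n e else 0ℤ

Ecoef-invSeqs : ∀ n f → Ecoef n f ≡ sumL (term f n) (invSeqs n)
Ecoef-invSeqs n f = sumL-filterᵇ avoids (weight f n) (invSeqs n)

Ecoef-suc : ∀ n f →
  Ecoef (suc n) f ≡ sumL (λ e → sumN (suc n) (λ x → term f (suc n) (e ∷ʳ x))) (invSeqs n)
Ecoef-suc n f = begin
  Ecoef (suc n) f                                   ≡⟨ Ecoef-invSeqs (suc n) f ⟩
  sumL t (concat (map children (invSeqs n)))        ≡⟨ sumL-concat t (map children (invSeqs n)) ⟩
  sumL (sumL t) (map children (invSeqs n))          ≡⟨ sumL-map (sumL t) children (invSeqs n) ⟩
  sumL (sumL t ∘ children) (invSeqs n)              ≡⟨ sumL-cong (invSeqs n) children-sum ⟩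
  sumL (λ e → sumN (suc n) (λ x → t (e ∷ʳ x))) (invSeqs n) ∎
  where
  t = term f (suc n)
  children : List ℕ → List (List ℕ)
  children e = map (e ∷ʳ_) (upTo (suc n))
  children-sum : ∀ e → sumL t (children e) ≡ sumN (suc n) (λ x → t (e ∷ʳ x))
  children-sum e = trans (sumL-map t (e ∷ʳ_) (upTo (suc n))) (sumL-applyUpTo (t ∘ (e ∷ʳ_)) id (suc n))

term-containing : ∀ f n e → has3 e ≡ true → term f n e ≡ 0ℤ
term-containing f n e = cong (λ c → if (if c then false else true) then weight f n e else 0ℤ)

term-avoiding : ∀ f n e → has3 e ≡ false → term f n e ≡ weight f n e
term-avoiding f n e = cong (λ c → if (if c then false else true) then weight f n e else 0ℤ)

weight-bounded : ∀ f {n} e → alpha e < n → weight f n e ≡ f (paramP e) (paramQ n e)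
weight-bounded f {n} e α<n =
  cong (λ c → if c then f (paramP e) (paramQ n e) else 0ℤ) (≤ᵇ-true (m<n⇒0<n∸m α<n))

term-avoider : ∀ f n e → has3 e ≡ false → alpha e < n → term f n e ≡ f (paramP e) (paramQ n e)
term-avoider f n e avoiding α<n = trans (term-avoiding f n e avoiding) (weight-bounded f e α<n)

term-∷ʳ-≤β : ∀ f n e {x} → x < betaSuc e → term f n (e ∷ʳ x) ≡ 0ℤ
term-∷ʳ-≤β f n e {x} x<β =
  term-containing f n (e ∷ʳ x)
    (trans (has3-∷ʳ e x) (trans (cong (has3 e ∨_) (<ᵇ-true x<β)) (∨-zeroʳ (has3 e))))

term-∷ʳ->β : ∀ f n e {x} → has3 e ≡ false → betaSuc e ≤ x → term f n (e ∷ʳ x) ≡ weight f n (e ∷ʳ x)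
term-∷ʳ->β f n e {x} avoiding β≤x =
  term-avoiding f n (e ∷ʳ x) (trans (has3-∷ʳ e x) (cong₂ _∨_ avoiding (<ᵇ-false β≤x)))

-- β < x ≤ α: the child keeps α, and x becomes its largest non-left-to-right maximum
term-∷ʳ-nonmax : ∀ f n y ys {x} → let e = y ∷ ys in
  has3 e ≡ false → betaSuc e ≤ x → x ≤ alpha e → alpha e < n →
  term f n (e ∷ʳ x) ≡ f (alpha e ∸ x) (n ∸ alpha e)
term-∷ʳ-nonmax f n y ys {x} avoiding β≤x x≤α α<n = begin
  term f n (e ∷ʳ x)
    ≡⟨ term-∷ʳ->β f n e avoiding β≤x ⟩
  weight f n (e ∷ʳ x)
    ≡⟨ weight-bounded f (e ∷ʳ x) (subst (_< n) (sym α′) α<n) ⟩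
  f (suc (alpha (e ∷ʳ x)) ∸ betaSuc (e ∷ʳ x)) (n ∸ alpha (e ∷ʳ x))
    ≡⟨ cong₂ (λ a b → f (suc a ∸ b) (n ∸ a)) α′ β′ ⟩
  f (alpha e ∸ x) (n ∸ alpha e) ∎
  where
  e = y ∷ ys
  α′ : alpha (e ∷ʳ x) ≡ alpha e
  α′ = trans (alpha-∷ʳ e x) (m≥n⇒m⊔n≡m x≤α)
  β′ : betaSuc (e ∷ʳ x) ≡ suc x
  β′ = trans (betaGo-∷ʳ y ys x)
             (trans (cong (λ c → if c then betaSuc e else suc x ⊔ betaSuc e) (<ᵇ-false x≤α))
                    (m≥n⇒m⊔n≡m (≤-trans β≤x (n≤1+n x))))

-- α < x: x becomes the new maximum and β is unchanged
term-∷ʳ-max : ∀ f n y ys {x} → let e = y ∷ ys in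
  has3 e ≡ false → alpha e < x → x < n →
  term f n (e ∷ʳ x) ≡ f (suc x ∸ betaSuc e) (n ∸ x)
term-∷ʳ-max f n y ys {x} avoiding α<x x<n = begin
  term f n (e ∷ʳ x)
    ≡⟨ term-∷ʳ->β f n e avoiding (≤-trans (betaGo≤ y ys) α<x) ⟩
  weight f n (e ∷ʳ x)
    ≡⟨ weight-bounded f (e ∷ʳ x) (subst (_< n) (sym α′) x<n) ⟩
  f (suc (alpha (e ∷ʳ x)) ∸ betaSuc (e ∷ʳ x)) (n ∸ alpha (e ∷ʳ x))
    ≡⟨ cong₂ (λ a b → f (suc a ∸ b) (n ∸ a)) α′ β′ ⟩
  f (suc x ∸ betaSuc e) (n ∸ x) ∎
  where
  e = y ∷ ys
  α′ : alpha (e ∷ʳ x) ≡ x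
  α′ = trans (alpha-∷ʳ e x) (m≤n⇒m⊔n≡n (<⇒≤ α<x))
  β′ : betaSuc (e ∷ʳ x) ≡ betaSuc e
  β′ = trans (betaGo-∷ʳ y ys x) (cong (λ c → if c then betaSuc e else suc x ⊔ betaSuc e) (<ᵇ-true α<x))

a∸[b+i]≡p∸[1+i] : ∀ {a b p} i → b ℕ.+ p ≡ suc a → a ∸ (b ℕ.+ i) ≡ p ∸ suc i
a∸[b+i]≡p∸[1+i] {a} {b} {p} i b+p≡1+a = begin
  suc a ∸ suc (b ℕ.+ i)     ≡⟨ cong (_∸ suc (b ℕ.+ i)) b+p≡1+a ⟨
  b ℕ.+ p ∸ suc (b ℕ.+ i)   ≡⟨ cong (b ℕ.+ p ∸_) (+-suc b i) ⟨
  b ℕ.+ p ∸ (b ℕ.+ suc i)   ≡⟨ [m+n]∸[m+o]≡n∸o b p (suc i) ⟩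
  p ∸ suc i                 ∎

[2+a+j]∸b≡1+p+j : ∀ {a b p} j → b ℕ.+ p ≡ suc a → suc (suc a ℕ.+ j) ∸ b ≡ suc (p ℕ.+ j)
[2+a+j]∸b≡1+p+j {a} {b} {p} j b+p≡1+a = begin
  suc (suc a ℕ.+ j) ∸ b       ≡⟨ cong (λ m → suc (m ℕ.+ j) ∸ b) b+p≡1+a ⟨
  suc (b ℕ.+ p ℕ.+ j) ∸ b     ≡⟨ cong (λ m → suc m ∸ b) (+-assoc b p j) ⟩
  suc (b ℕ.+ (p ℕ.+ j)) ∸ b   ≡⟨ cong (_∸ b) (+-suc b (p ℕ.+ j)) ⟨
  b ℕ.+ suc (p ℕ.+ j) ∸ b     ≡⟨ m+n∸m≡n b (suc (p ℕ.+ j)) ⟩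
  suc (p ℕ.+ j)               ∎

children-sum : ∀ f n y ys → let e = y ∷ ys; p = paramP e; q = paramQ n e in
  has3 e ≡ false → alpha e < n →
  sumN (suc n) (λ x → term f (suc n) (e ∷ʳ x))
    ≡ sumN p (λ i → f (p ∸ suc i) (suc q)) + sumN q (λ j → f (suc (p ℕ.+ j)) (q ∸ j))
children-sum f n y ys avoiding α<n = begin
  sumN (suc n) F
    ≡⟨ cong (λ m → sumN m F) length-split ⟩
  sumN (b ℕ.+ p ℕ.+ q) F
    ≡⟨ sumN-blocks b p q F ⟩
  sumN b F + sumN p (λ i → F (b ℕ.+ i)) + sumN q (λ j → F (b ℕ.+ p ℕ.+ j))
    ≡⟨ cong₂ _+_ (cong₂ _+_ (sumN-zero b below) (sumN-cong p middle)) (sumN-cong q top) ⟩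
  0ℤ + Mid + Top
    ≡⟨ cong (_+ Top) (ℤ.+-identityˡ Mid) ⟩
  Mid + Top ∎
  where
  e = y ∷ ys
  a = alpha e
  b = betaSuc e
  p = paramP e
  q = paramQ n e
  Mid = sumN p (λ i → f (p ∸ suc i) (suc q))
  Top = sumN q (λ j → f (suc (p ℕ.+ j)) (q ∸ j))
  F : ℕ → ℤ
  F x = term f (suc n) (e ∷ʳ x)
  b+p≡1+a : b ℕ.+ p ≡ suc a
  b+p≡1+a = m+[n∸m]≡n (betaGo≤ y ys)
  a+q≡n : a ℕ.+ q ≡ n
  a+q≡n = m+[n∸m]≡n (<⇒≤ α<n)
  length-split : suc n ≡ b ℕ.+ p ℕ.+ q
  length-split = trans (cong suc (sym a+q≡n)) (cong (ℕ._+ q) (sym b+p≡1+a))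
  below : ∀ {x} → x < b → F x ≡ 0ℤ
  below = term-∷ʳ-≤β f (suc n) e
  middle : ∀ {i} → i < p → F (b ℕ.+ i) ≡ f (p ∸ suc i) (suc q)
  middle {i} i<p =
    trans (term-∷ʳ-nonmax f (suc n) y ys avoiding (m≤m+n b i) b+i≤a (≤-trans α<n (n≤1+n n)))
          (cong₂ f (a∸[b+i]≡p∸[1+i] {a} {b} {p} i b+p≡1+a) (+-∸-assoc 1 (<⇒≤ α<n)))
    where
    b+i≤a : b ℕ.+ i ≤ a
    b+i≤a = ≤-pred (subst₂ _≤_ (+-suc b i) b+p≡1+a (+-monoʳ-≤ b i<p))
  top : ∀ {j} → j < q → F (b ℕ.+ p ℕ.+ j) ≡ f (suc (p ℕ.+ j)) (q ∸ j)
  top {j} j<q = begin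
    F (b ℕ.+ p ℕ.+ j)
      ≡⟨ cong (λ m → F (m ℕ.+ j)) b+p≡1+a ⟩
    F (suc a ℕ.+ j)
      ≡⟨ term-∷ʳ-max f (suc n) y ys avoiding (s≤s (m≤m+n a j))
                     (s≤s (subst (suc (a ℕ.+ j) ≤_) a+q≡n (+-monoʳ-< a j<q))) ⟩
    f (suc (suc a ℕ.+ j) ∸ b) (n ∸ (a ℕ.+ j))
      ≡⟨ cong₂ f ([2+a+j]∸b≡1+p+j {a} {b} {p} j b+p≡1+a)
                 (trans (cong (_∸ (a ℕ.+ j)) (sym a+q≡n)) ([m+n]∸[m+o]≡n∸o a q j)) ⟩
    f (suc (p ℕ.+ j)) (q ∸ j) ∎

mono : ℤ → ℤ → ℕ → ℕ → ℤ
mono x y p q = x ^ p * y ^ q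

-- The share of one avoider with parameters (p, q): both sums over its children are geometric.
children-identity : ∀ u v p q →
  (1ℤ - u) * (u - v) * (sumN p (λ i → mono u v (p ∸ suc i) (suc q))
                        + sumN q (λ j → mono u v (suc (p ℕ.+ j)) (q ∸ j)))
    + (v * (u - v) + v * u * (1ℤ - u)) * mono u v p q
  ≡ v * (u - v) * mono 1ℤ v p q + v * u * (1ℤ - u) * mono u u p q
children-identity u v p q = begin
  c₁ * (Mid + Top) + c * (U * V)
    ≡⟨ cong (λ s → c₁ * s + c * (U * V)) (cong₂ _+_ middle top) ⟩
  c₁ * (v * V * geomSum 1ℤ u p + u * U * v * geomSum u v q) + c * (U * V)
    ≡⟨ regroup u v U V (geomSum 1ℤ u p) (geomSum u v q) ⟩
  v * V * (u - v) * ((1ℤ - u) * geomSum 1ℤ u p) + u * U * v * (1ℤ - u) * ((u - v) * geomSum u v q)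
    + c * (U * V)
    ≡⟨ cong₂ (λ s t → v * V * (u - v) * s + u * U * v * (1ℤ - u) * t + c * (U * V))
             (geometric 1ℤ u p) (geometric u v q) ⟩
  v * V * (u - v) * (1ℤ ^ p - U) + u * U * v * (1ℤ - u) * (u ^ q - V) + c * (U * V)
    ≡⟨ collect u v U V (u ^ q) (1ℤ ^ p) ⟩
  v * (u - v) * (1ℤ ^ p * V) + v * u * (1ℤ - u) * (U * u ^ q) ∎
  where
  U = u ^ p
  V = v ^ q
  c₁ = (1ℤ - u) * (u - v)
  c = v * (u - v) + v * u * (1ℤ - u)
  Mid = sumN p (λ i → mono u v (p ∸ suc i) (suc q))
  Top = sumN q (λ j → mono u v (suc (p ℕ.+ j)) (q ∸ j))
  middle : Mid ≡ v * V * geomSum 1ℤ u p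
  middle = trans (sumN-cong p (λ {i} _ → pointwise i)) (sumN-*ˡ p (v * V) _)
    where
    pointwise : ∀ i → u ^ (p ∸ suc i) * (v * V) ≡ v * V * (1ℤ ^ i * u ^ (p ∸ suc i))
    pointwise i = begin
      u ^ (p ∸ suc i) * (v * V)                 ≡⟨ ℤ.*-comm (u ^ (p ∸ suc i)) (v * V) ⟩
      v * V * u ^ (p ∸ suc i)                   ≡⟨ cong (v * V *_) (ℤ.*-identityˡ (u ^ (p ∸ suc i))) ⟨
      v * V * (1ℤ * u ^ (p ∸ suc i))            ≡⟨ cong (λ o → v * V * (o * u ^ (p ∸ suc i))) (ℤ.^-zeroˡ i) ⟨
      v * V * (1ℤ ^ i * u ^ (p ∸ suc i))        ∎
  top : Top ≡ u * U * v * geomSum u v q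
  top = trans (sumN-cong q pointwise) (sumN-*ˡ q (u * U * v) _)
    where
    shuffle : ∀ u v U J W → u * (U * J) * (v * W) ≡ u * U * v * (J * W)
    shuffle = solve-∀
    pointwise : ∀ {j} → j < q → mono u v (suc (p ℕ.+ j)) (q ∸ j) ≡ u * U * v * (u ^ j * v ^ (q ∸ suc j))
    pointwise {j} j<q = begin
      u * u ^ (p ℕ.+ j) * v ^ (q ∸ j)
        ≡⟨ cong₂ (λ s t → u * s * v ^ t) (ℤ.^-distribˡ-+-* u p j) (+-∸-assoc 1 j<q) ⟩
      u * (U * u ^ j) * (v * v ^ (q ∸ suc j))
        ≡⟨ shuffle u v U (u ^ j) (v ^ (q ∸ suc j)) ⟩
      u * U * v * (u ^ j * v ^ (q ∸ suc j)) ∎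
  regroup : ∀ u v U V G H →
    (1ℤ - u) * (u - v) * (v * V * G + u * U * v * H) + (v * (u - v) + v * u * (1ℤ - u)) * (U * V)
    ≡ v * V * (u - v) * ((1ℤ - u) * G) + u * U * v * (1ℤ - u) * ((u - v) * H)
      + (v * (u - v) + v * u * (1ℤ - u)) * (U * V)
  regroup = solve-∀
  collect : ∀ u v U V W O →
    v * V * (u - v) * (O - U) + u * U * v * (1ℤ - u) * (W - V) + (v * (u - v) + v * u * (1ℤ - u)) * (U * V)
    ≡ v * (u - v) * (O * V) + v * u * (1ℤ - u) * (U * W)
  collect = solve-∀

data HasMax≤ (k : ℕ) : List ℕ → Set where
  hasMax≤ : ∀ {y ys} → alpha (y ∷ ys) ≤ k → HasMax≤ k (y ∷ ys)

invSeqs-hasMax≤ : ∀ k → All (HasMax≤ k) (invSeqs (suc k))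
invSeqs-hasMax≤ zero    = hasMax≤ z≤n ∷ []
invSeqs-hasMax≤ (suc k) =
  concat⁺ (map⁺ (All.map (λ h → map⁺ (applyUpTo⁺₁ id (suc (suc k)) (extend h))) (invSeqs-hasMax≤ k)))
  where
  extend : ∀ {e x} → HasMax≤ k e → x < suc (suc k) → HasMax≤ (suc k) (e ∷ʳ x)
  extend {y ∷ ys} {x} (hasMax≤ α≤k) x≤1+k =
    hasMax≤ (subst (_≤ suc k) (sym (alpha-∷ʳ (y ∷ ys) x)) (⊔-lub (≤-trans α≤k (n≤1+n k)) (≤-pred x≤1+k)))

sequence-identity : ∀ u v k {e} → HasMax≤ k e →
  (1ℤ - u) * (u - v) * sumN (suc (suc k)) (λ x → term (mono u v) (suc (suc k)) (e ∷ʳ x))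
    + (v * (u - v) + v * u * (1ℤ - u)) * term (mono u v) (suc k) e
  ≡ v * (u - v) * term (mono 1ℤ v) (suc k) e + v * u * (1ℤ - u) * term (mono u u) (suc k) e
sequence-identity u v k {y ∷ ys} (hasMax≤ α≤k) with has3 (y ∷ ys) Bool.≟ true
... | yes contains = begin
  c₁ * sumN (suc n) children + c * term (mono u v) n e
    ≡⟨ cong₂ (λ s t → c₁ * s + c * t) (sumN-zero (suc n) (λ {x} _ → child-contains x))
                                       (term-containing (mono u v) n e contains) ⟩
  c₁ * 0ℤ + c * 0ℤ
    ≡⟨ cong₂ _+_ (ℤ.*-zeroʳ c₁) (ℤ.*-zeroʳ c) ⟩
  0ℤ
    ≡⟨ cong₂ _+_ (ℤ.*-zeroʳ c₂) (ℤ.*-zeroʳ c₃) ⟨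
  c₂ * 0ℤ + c₃ * 0ℤ
    ≡⟨ cong₂ (λ s t → c₂ * s + c₃ * t) (term-containing (mono 1ℤ v) n e contains)
                                        (term-containing (mono u u) n e contains) ⟨
  c₂ * term (mono 1ℤ v) n e + c₃ * term (mono u u) n e ∎
  where
  e = y ∷ ys
  n = suc k
  c₁ = (1ℤ - u) * (u - v)
  c₂ = v * (u - v)
  c₃ = v * u * (1ℤ - u)
  c = c₂ + c₃
  children : ℕ → ℤ
  children x = term (mono u v) (suc n) (e ∷ʳ x)
  child-contains : ∀ x → children x ≡ 0ℤ
  child-contains x = term-containing (mono u v) (suc n) (e ∷ʳ x)
                       (trans (has3-∷ʳ e x) (cong (_∨ (x <ᵇ betaSuc e)) contains))
... | no ¬contains = begin
  c₁ * sumN (suc n) (λ x → term (mono u v) (suc n) (e ∷ʳ x)) + c * term (mono u v) n e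
    ≡⟨ cong₂ (λ s t → c₁ * s + c * t) (children-sum (mono u v) n y ys avoiding α<n)
                                       (term-avoider (mono u v) n e avoiding α<n) ⟩
  c₁ * (sumN p (λ i → mono u v (p ∸ suc i) (suc q)) + sumN q (λ j → mono u v (suc (p ℕ.+ j)) (q ∸ j)))
    + c * mono u v p q
    ≡⟨ children-identity u v p q ⟩
  c₂ * mono 1ℤ v p q + c₃ * mono u u p q
    ≡⟨ cong₂ (λ s t → c₂ * s + c₃ * t) (term-avoider (mono 1ℤ v) n e avoiding α<n)
                                        (term-avoider (mono u u) n e avoiding α<n) ⟨
  c₂ * term (mono 1ℤ v) n e + c₃ * term (mono u u) n e ∎
  where
  e = y ∷ ys
  n = suc k
  p = paramP e
  q = paramQ n e
  avoiding : has3 e ≡ false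
  avoiding = ¬-not ¬contains
  α<n : alpha e < n
  α<n = s≤s α≤k
  c₁ = (1ℤ - u) * (u - v)
  c₂ = v * (u - v)
  c₃ = v * u * (1ℤ - u)
  c = c₂ + c₃

proposition2p3 : (m : ℕ) (u v : ℤ) →
    (1ℤ - u) * (u - v) * E[u,v] (suc m) u v
      + v * (u - v) * E[u,v] m u v
      + v * u * (1ℤ - u) * E[u,v] m u v
    ≡ (case-m m) * (u * v * ((1ℤ - u) * (u - v)))
      + v * (u - v) * E[1,v] m v
      + v * u * (1ℤ - u) * E[u,u] m u
proposition2p3 zero    u v = first-coefficient u v
  where
  -- I₁ = {(0)} has parameters (1, 1), and the empty sequence has q = 0
  first-coefficient : ∀ u v →
    (1ℤ - u) * (u - v) * (u * 1ℤ * (v * 1ℤ) + 0ℤ) + v * (u - v) * 0ℤ + v * u * (1ℤ - u) * 0ℤ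
    ≡ 1ℤ * (u * v * ((1ℤ - u) * (u - v))) + v * (u - v) * 0ℤ + v * u * (1ℤ - u) * 0ℤ
  first-coefficient = solve-∀
proposition2p3 (suc k) u v = begin
  c₁ * E[u,v] (suc n) u v + c₂ * E[u,v] n u v + c₃ * E[u,v] n u v
    ≡⟨ factor c₁ c₂ c₃ (E[u,v] (suc n) u v) (E[u,v] n u v) ⟩
  c₁ * E[u,v] (suc n) u v + c * E[u,v] n u v
    ≡⟨ cong₂ (λ s t → c₁ * s + c * t) (Ecoef-suc n (mono u v)) (Ecoef-invSeqs n (mono u v)) ⟩
  c₁ * sumL children (invSeqs n) + c * sumL (term (mono u v) n) (invSeqs n)
    ≡⟨ sumL-lincomb c₁ c children (term (mono u v) n) (invSeqs n) ⟩
  sumL (λ e → c₁ * children e + c * term (mono u v) n e) (invSeqs n)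
    ≡⟨ sumL-congᴬ (invSeqs-hasMax≤ k) (sequence-identity u v k) ⟩
  sumL (λ e → c₂ * term (mono 1ℤ v) n e + c₃ * term (mono u u) n e) (invSeqs n)
    ≡⟨ sumL-lincomb c₂ c₃ (term (mono 1ℤ v) n) (term (mono u u) n) (invSeqs n) ⟨
  c₂ * sumL (term (mono 1ℤ v) n) (invSeqs n) + c₃ * sumL (term (mono u u) n) (invSeqs n)
    ≡⟨ cong₂ (λ s t → c₂ * s + c₃ * t) (Ecoef-invSeqs n (mono 1ℤ v)) (Ecoef-invSeqs n (mono u u)) ⟨
  c₂ * E[1,v] n v + c₃ * E[u,u] n u
    ≡⟨ cong (_+ c₃ * E[u,u] n u) (ℤ.+-identityˡ (c₂ * E[1,v] n v)) ⟨
  -- case-m (suc k) * _ reduces to 0ℤ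
  0ℤ + c₂ * E[1,v] n v + c₃ * E[u,u] n u ∎
  where
  n = suc k
  c₁ = (1ℤ - u) * (u - v)
  c₂ = v * (u - v)
  c₃ = v * u * (1ℤ - u)
  c = c₂ + c₃
  children : List ℕ → ℤ
  children e = sumN (suc n) (λ x → term (mono u v) (suc n) (e ∷ʳ x))
  factor : ∀ a b c X Y → a * X + b * Y + c * Y ≡ a * X + (b + c) * Y
  factor = solve-∀
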